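{- Let $q$ be an even positive integer and $n\ge1$. Then the function $f:\mathbb{Z}_q^n\to\mathbb{Z}_{2q}$ defined by $$f(x_1,\ldots,x_n)=\hat{x}_1^2+\cdots+\hat{x}_n^2-\hat{x}_1-\cdots-\hat{x}_n \pmod{2q}$$ is a $2q$-negabent function.
   Context: $\mathbb{Z}_m$ is the ring of integers modulo $m$. For $x\in\mathbb{Z}_q$, $\hat{x}\in\{0,\ldots,q-1\}$ is its least non-negative integer representative, and $\hat{\mathbf{x}}=(\hat{x}_1,\ldots,\hat{x}_n)$. Let $\xi$ be a primitive $q$-th root of unity and $\omega$ a primitive $2q$-th root of unity; $\langle\hat{\mathbf{x}},\hat{\mathbf{u}}\rangle=\sum_i\hat x_i\hat u_i$. The $2q$-nega-Hadamard transform of $f:\mathbb{Z}_q^n\to\mathbb{Z}_{2q}$ is $\mathcal{N}_f(\mathbf{u})=q^{ -n/2}\sum_{\mathbf{x}\in\mathbb{Z}_q^n}\omega^{f(\mathbf{x})}\xi^{\langle\hat{\mathbf{x}},\hat{\mathbf{u}}\rangle}\omega^{\sum_i\hat{x}_i}$, and $f$ is $2q$-negabent if $|\mathcal{N}_f(\mathbf{u})|=1$ for all $\mathbf{u}\in\mathbb{Z}_q^n$. -}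

module Defs where

open import Level using (_⊔_)
open import Algebra.Bundles using (CommutativeRing)
open import Data.Nat as ℕ using (ℕ; zero; suc; NonZero; _<_)
open import Data.Nat.Properties using (m*n≢0)
open import Data.Fin using (Fin; toℕ; fromℕ<)
open import Data.Vec as V using (Vec; []; _∷_)
open import Data.List as L using (List)
import Data.Integer as ℤ
open import Data.Integer.DivMod using (_%ℕ_; n%ℕd<d)
open import Data.Product using (_×_; ∃)
open import Relation.Nullary using (¬_)

-- ℤ_m is represented by Fin m; the least non-negative representative x̂ is toℕ x.

allVecs : (q n : ℕ) → List (Vec (Fin q) n)
allVecs q zero    = [] L.∷ L.[]
allVecs q (suc n) = L.concatMap (λ x → L.map (x ∷_) (allVecs q n)) (L.allFin q)

sumHat : ∀ {q n} → Vec (Fin q) n → ℕ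
sumHat x = V.sum (V.map toℕ x)

sumSqHat : ∀ {q n} → Vec (Fin q) n → ℕ
sumSqHat x = V.sum (V.map (λ a → toℕ a ℕ.* toℕ a) x)

innerHat : ∀ {q n} → Vec (Fin q) n → Vec (Fin q) n → ℕ
innerHat x u = V.sum (V.zipWith (λ a b → toℕ a ℕ.* toℕ b) x u)

fQuad : (q : ℕ) .{{_ : NonZero q}} (n : ℕ) → Vec (Fin q) n → Fin (2 ℕ.* q)
fQuad q n x =
  fromℕ< (n%ℕd<d z (2 ℕ.* q) {{m*n≢0 2 q}})
  where
  z : ℤ.ℤ
  z = ℤ.+ sumSqHat x ℤ.- ℤ.+ sumHat x

module _ {c ℓ} (R : CommutativeRing c ℓ) where
  open CommutativeRing R

  pow : Carrier → ℕ → Carrier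
  pow x zero    = 1#
  pow x (suc k) = x * pow x k

  natR : ℕ → Carrier
  natR zero    = 0#
  natR (suc k) = 1# + natR k

  sumL : ∀ {a} {A : Set a} → List A → (A → Carrier) → Carrier
  sumL L.[]       g = 0#
  sumL (a L.∷ as) g = g a + sumL as g

  IsField : Set (c ⊔ ℓ)
  IsField = (¬ (1# ≈ 0#)) × (∀ x → ¬ (x ≈ 0#) → ∃ λ y → x * y ≈ 1#)

  CharacteristicZero : Set ℓ
  CharacteristicZero = ∀ m → ¬ (natR (suc m) ≈ 0#)

  IsPrimitiveRoot : ℕ → Carrier → Set ℓ
  IsPrimitiveRoot m ζ = pow ζ m ≈ 1# × (∀ k → 0 < k → k < m → ¬ (pow ζ k ≈ 1#))

  -- Unnormalised 2q-nega-Hadamard transform with parameters (ω, ξ):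
  --   S_f(u) = Σ_x ω^{f(x)} ξ^{⟨x̂,û⟩} ω^{Σ x̂_i},   so 𝒩_f(u) = q^{-n/2} S_f(u).
  negaSum : (q n : ℕ) → Carrier → Carrier →
            (Vec (Fin q) n → Fin (2 ℕ.* q)) → Vec (Fin q) n → Carrier
  negaSum q n ω ξ f u =
    sumL (allVecs q n) (λ x → pow ω (toℕ (f x)) * pow ξ (innerHat x u) * pow ω (sumHat x))

  -- Its complex conjugate: conjugation sends ω ↦ ω⁻¹ = ω^{2q-1} and ξ ↦ ξ⁻¹ = ξ^{q-1}.
  negaSumConj : (q n : ℕ) → Carrier → Carrier →
                (Vec (Fin q) n → Fin (2 ℕ.* q)) → Vec (Fin q) n → Carrier
  negaSumConj q n ω ξ f u =
    negaSum q n (pow ω (2 ℕ.* q ℕ.∸ 1)) (pow ξ (q ℕ.∸ 1)) f u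

  -- f is 2q-negabent:  |𝒩_f(u)|² = 1 for all u, i.e.  S_f(u) · conj(S_f(u)) = q^n.
  IsNegabent : (q n : ℕ) → Carrier → Carrier →
               (Vec (Fin q) n → Fin (2 ℕ.* q)) → Set ℓ
  IsNegabent q n ω ξ f =
    ∀ (u : Vec (Fin q) n) →
      negaSum q n ω ξ f u * negaSumConj q n ω ξ f u ≈ natR (q ℕ.^ n)

{-# OPTIONS --safe #-}
module Submission where

-- Since ξ = ω² and f(x) + Σ x̂ᵢ ≡ Σ x̂ᵢ² (mod 2q), every summand of the nega-Hadamard
-- sum is ∏ᵢ ω^(x̂ᵢ² + 2 x̂ᵢ ûᵢ), so the sum factors as ∏ᵢ G_ω(ûᵢ) with
-- G_ω(b) = Σ_{a<q} ω^(a² + 2ab), and its conjugate is the same product for ω⁻¹ = ω^(2q-1).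
-- As q is even, a ↦ ω^(a² + 2ab) is q-periodic, so G_ω(b) = Σ_a ω^((a+c)² + 2(a+c)b) for
-- every c.  Multiplying by ω^-(c² + 2cb) and summing over c turns G_ω(b) G_ω⁻¹(b) into
-- Σ_a ω^(a² + 2ab) Σ_c ξ^(ac); orthogonality of the powers of the primitive q-th root ξ
-- leaves only a = 0, giving q, so the transform times its conjugate is q^n.

open import Defs
open import Algebra.Bundles using (CommutativeRing)
open import Data.Nat as ℕ using (ℕ; zero; suc; NonZero)
import Data.Nat.Properties as ℕₚ
open import Data.Nat.DivMod using (_%_; _/_; m≡m%n+[m/n]*n)
open import Data.Nat.Divisibility using (_∣_; divides)
open import Data.Fin as Fin using (Fin; toℕ)
import Data.Fin.Properties as Finₚ
open import Data.Vec as V using (Vec; []; _∷_)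
import Data.Integer as ℤ
import Data.Integer.Properties as ℤₚ
open import Data.Product using (∃; _,_; proj₁; proj₂)
open import Data.List as L using (List)
open import Function using (_∘_)
open import Relation.Nullary using (¬_)
open import Relation.Binary.PropositionalEquality as ≡ using (_≡_)

module Exponents where
  open import Data.Nat using (_+_; _*_; _≤_)
  open import Data.Nat.Tactic.RingSolver using (solve-∀)

  quad : ℕ → ℕ → ℕ
  quad b a = a * a + 2 * (a * b)

  quad-+ : ∀ b a c → quad b (a + c) ≡ quad b a + 2 * (a * c) + quad b c
  quad-+ b a c = identity b a c
    where
    identity : ∀ b a c → (a + c) * (a + c) + 2 * ((a + c) * b) ≡
                         a * a + 2 * (a * b) + 2 * (a * c) + (c * c + 2 * (c * b))
    identity = solve-∀

  quad-periodic : ∀ b a r q → q ≡ r * 2 → quad b (a + q) ≡ quad b a + 2 * q * (a + b + r)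
  quad-periodic b a r q ≡.refl = identity b a r
    where
    identity : ∀ b a r → (a + r * 2) * (a + r * 2) + 2 * ((a + r * 2) * b) ≡
                         a * a + 2 * (a * b) + 2 * (r * 2) * (a + b + r)
    identity = solve-∀

  sumSqHat-+-innerHat-∷ : ∀ {q n} a b (x u : Vec (Fin q) n) →
    sumSqHat (a ∷ x) + 2 * innerHat (a ∷ x) (b ∷ u) ≡
    quad (toℕ b) (toℕ a) + (sumSqHat x + 2 * innerHat x u)
  sumSqHat-+-innerHat-∷ a b x u =
    identity (toℕ a * toℕ a) (sumSqHat x) (toℕ a * toℕ b) (innerHat x u)
    where
    identity : ∀ A S B I → (A + S) + 2 * (B + I) ≡ (A + 2 * B) + (S + 2 * I)
    identity = solve-∀

  sumHat≤sumSqHat : ∀ {q n} (x : Vec (Fin q) n) → sumHat x ≤ sumSqHat x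
  sumHat≤sumSqHat []      = ℕ.z≤n
  sumHat≤sumSqHat (a ∷ x) = ℕₚ.+-mono-≤ (n≤n*n (toℕ a)) (sumHat≤sumSqHat x)
    where
    n≤n*n : ∀ n → n ≤ n * n
    n≤n*n zero      = ℕ.z≤n
    n≤n*n n@(suc _) = ℕₚ.m≤m*n n n

  fQuad-residue : ∀ q .{{_ : NonZero q}} n (x : Vec (Fin q) n) →
    ∃ λ k → sumSqHat x ≡ toℕ (fQuad q n x) + sumHat x + 2 * q * k
  fQuad-residue q n x = D / M , (begin
    S                              ≡⟨ ℕₚ.m∸n+n≡m (sumHat≤sumSqHat x) ⟨
    D + T                          ≡⟨ ≡.cong (_+ T) (m≡m%n+[m/n]*n D M) ⟩
    D % M + D / M * M + T          ≡⟨ right-comm (D % M) (D / M * M) T ⟩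
    D % M + T + D / M * M          ≡⟨ ≡.cong₂ (λ r m → r + T + m) toℕ-fQuad (ℕₚ.*-comm M (D / M)) ⟨
    toℕ (fQuad q n x) + T + M * (D / M) ∎)
    where
    open ≡.≡-Reasoning
    S T D M : ℕ
    S = sumSqHat x
    T = sumHat x
    D = S ℕ.∸ T
    M = 2 * q
    right-comm : ∀ a b c → a + b + c ≡ a + c + b
    right-comm = solve-∀
    instance
      M≢0 : NonZero M
      M≢0 = ℕₚ.m*n≢0 2 q
    toℕ-fQuad : toℕ (fQuad q n x) ≡ D % M
    toℕ-fQuad = ≡.trans (Finₚ.toℕ-fromℕ< _)
      (≡.cong (ℤ._%ℕ M) (≡.trans (ℤₚ.m-n≡m⊖n S T) (ℤₚ.⊖-≥ (sumHat≤sumSqHat x))))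

  fQuad-exponent : ∀ q .{{_ : NonZero q}} n (x u : Vec (Fin q) n) → ∃ λ k →
    sumSqHat x + 2 * innerHat x u ≡
    toℕ (fQuad q n x) + 2 * innerHat x u + sumHat x + 2 * q * k
  fQuad-exponent q n x u with fQuad-residue q n x
  ... | k , residue = k , ≡.trans (≡.cong (_+ 2 * innerHat x u) residue)
                                  (identity (toℕ (fQuad q n x)) (sumHat x) (2 * q * k) (2 * innerHat x u))
    where
    identity : ∀ r t m i → r + t + m + i ≡ r + i + t + m
    identity = solve-∀

open Exponents

module GaussSums {c ℓ} (K : CommutativeRing c ℓ) where
  open CommutativeRing K
  open import Algebra.Properties.CommutativeSemiring.Exp commutativeSemiring
    using (_^_; ^-homo-*; ^-assocʳ; ^-distrib-*; ^-congˡ)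
  open import Algebra.Properties.Semiring.Sum semiring
    using (sum-syntax; sum-cong-≋; sum-replicate; sum-replicate-zero; sum-init-last;
           ∑-comm; *-distribˡ-sum; *-distribʳ-sum)
  open import Algebra.Properties.Semiring.Mult semiring using (_×_; ×1-homo-*)
  open import Algebra.Properties.Ring ring using (-‿distribˡ-*)
  open import Algebra.Properties.AbelianGroup +-abelianGroup using (∙-cancelʳ)
  open import Algebra.Properties.CommutativeSemigroup *-commutativeSemigroup using (interchange)
  open import Relation.Binary.Reasoning.Setoid setoid

  pow≡^ : ∀ x k → pow K x k ≡ x ^ k
  pow≡^ x zero    = ≡.refl
  pow≡^ x (suc k) = ≡.cong (x *_) (pow≡^ x k)

  pow-+ : ∀ x m n → pow K x (m ℕ.+ n) ≈ pow K x m * pow K x n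
  pow-+ x m n rewrite pow≡^ x (m ℕ.+ n) | pow≡^ x m | pow≡^ x n = ^-homo-* x m n

  pow-* : ∀ x m n → pow K x (m ℕ.* n) ≈ pow K (pow K x m) n
  pow-* x m n rewrite pow≡^ (pow K x m) n | pow≡^ x m | pow≡^ x (m ℕ.* n) = sym (^-assocʳ x m n)

  pow-distrib-* : ∀ x y k → pow K (x * y) k ≈ pow K x k * pow K y k
  pow-distrib-* x y k rewrite pow≡^ (x * y) k | pow≡^ x k | pow≡^ y k = ^-distrib-* x y k

  pow-congˡ : ∀ {x y} k → x ≈ y → pow K x k ≈ pow K y k
  pow-congˡ {x} {y} k x≈y rewrite pow≡^ x k | pow≡^ y k = ^-congˡ k x≈y

  pow-1# : ∀ k → pow K 1# k ≈ 1#
  pow-1# zero    = refl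
  pow-1# (suc k) = trans (*-identityˡ _) (pow-1# k)

  pow-periodic : ∀ x m → pow K x m ≈ 1# → ∀ a k → pow K x (a ℕ.+ m ℕ.* k) ≈ pow K x a
  pow-periodic x m xᵐ≈1 a k = begin
    pow K x (a ℕ.+ m ℕ.* k)           ≈⟨ pow-+ x a (m ℕ.* k) ⟩
    pow K x a * pow K x (m ℕ.* k)     ≈⟨ *-congˡ (pow-* x m k) ⟩
    pow K x a * pow K (pow K x m) k   ≈⟨ *-congˡ (trans (pow-congˡ k xᵐ≈1) (pow-1# k)) ⟩
    pow K x a * 1#                    ≈⟨ *-identityʳ _ ⟩
    pow K x a                         ∎

  pow-square : ∀ {ω ξ} → ξ ≈ pow K ω 2 → ∀ k → pow K ω (2 ℕ.* k) ≈ pow K ξ k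
  pow-square ξ≈ω² k = trans (pow-* _ 2 k) (pow-congˡ k (sym ξ≈ω²))

  pow-inverse : ∀ {x y} → x * y ≈ 1# → ∀ k → pow K x k * pow K y k ≈ 1#
  pow-inverse xy≈1 k = trans (sym (pow-distrib-* _ _ k)) (trans (pow-congˡ k xy≈1) (pow-1# k))

  inverse-pow≈1 : ∀ {x y} k → x * y ≈ 1# → pow K x k ≈ 1# → pow K y k ≈ 1#
  inverse-pow≈1 {x} {y} k xy≈1 xᵏ≈1 = begin
    pow K y k                  ≈⟨ *-identityˡ _ ⟨
    1# * pow K y k             ≈⟨ *-congʳ xᵏ≈1 ⟨
    pow K x k * pow K y k      ≈⟨ pow-inverse xy≈1 k ⟩
    1#                         ∎

  pow-pred-inverse : ∀ x m .{{_ : NonZero m}} → pow K x m ≈ 1# → x * pow K x (m ℕ.∸ 1) ≈ 1#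
  pow-pred-inverse x (suc m) xᵐ⁺¹≈1 = xᵐ⁺¹≈1

  inverse-unique : ∀ {a x y} → a * x ≈ 1# → a * y ≈ 1# → x ≈ y
  inverse-unique {a} {x} {y} ax≈1 ay≈1 = begin
    x              ≈⟨ *-identityʳ x ⟨
    x * 1#         ≈⟨ *-congˡ ay≈1 ⟨
    x * (a * y)    ≈⟨ *-assoc x a y ⟨
    x * a * y      ≈⟨ *-congʳ (trans (*-comm x a) ax≈1) ⟩
    1# * y         ≈⟨ *-identityˡ y ⟩
    y              ∎

  ≉1∧*-fixed⇒≈0 : IsField K → ∀ {x y} → ¬ x ≈ 1# → x * y ≈ y → y ≈ 0#
  ≉1∧*-fixed⇒≈0 (_ , inverse) {x} {y} x≉1 xy≈y = begin
    y                    ≈⟨ *-identityˡ y ⟨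
    1# * y               ≈⟨ *-congʳ (trans (*-comm t (x - 1#)) t-inverse) ⟨
    t * (x - 1#) * y     ≈⟨ *-assoc t (x - 1#) y ⟩
    t * ((x - 1#) * y)   ≈⟨ *-congˡ [x-1]y≈0 ⟩
    t * 0#               ≈⟨ zeroʳ t ⟩
    0#                   ∎
    where
    x-1≉0 : ¬ x - 1# ≈ 0#
    x-1≉0 x-1≈0 = x≉1 (begin
      x                  ≈⟨ +-identityʳ x ⟨
      x + 0#             ≈⟨ +-congˡ (-‿inverseˡ 1#) ⟨
      x + (- 1# + 1#)    ≈⟨ +-assoc x (- 1#) 1# ⟨
      x - 1# + 1#        ≈⟨ +-congʳ x-1≈0 ⟩
      0# + 1#            ≈⟨ +-identityˡ 1# ⟩
      1#                 ∎)
    t : Carrier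
    t = proj₁ (inverse (x - 1#) x-1≉0)
    t-inverse : (x - 1#) * t ≈ 1#
    t-inverse = proj₂ (inverse (x - 1#) x-1≉0)
    [x-1]y≈0 : (x - 1#) * y ≈ 0#
    [x-1]y≈0 = begin
      (x - 1#) * y       ≈⟨ distribʳ y x (- 1#) ⟩
      x * y + - 1# * y   ≈⟨ +-congˡ (-‿distribˡ-* 1# y) ⟨
      x * y - 1# * y     ≈⟨ +-cong xy≈y (-‿cong (*-identityˡ y)) ⟩
      y - y              ≈⟨ -‿inverseʳ y ⟩
      0#                 ∎

  natR≡×1# : ∀ k → natR K k ≡ k × 1#
  natR≡×1# zero    = ≡.refl
  natR≡×1# (suc k) = ≡.cong (1# +_) (natR≡×1# k)

  natR-* : ∀ m n → natR K (m ℕ.* n) ≈ natR K m * natR K n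
  natR-* m n rewrite natR≡×1# (m ℕ.* n) | natR≡×1# m | natR≡×1# n = ×1-homo-* m n

  ∑-init-last : ∀ q (F : ℕ → Carrier) → ∑[ i < suc q ] F (toℕ i) ≈ ∑[ i < q ] F (toℕ i) + F q
  ∑-init-last q F = begin
    ∑[ i < suc q ] F (toℕ i)                                ≈⟨ sum-init-last {q} (F ∘ toℕ) ⟩
    ∑[ i < q ] F (toℕ (Fin.inject₁ i)) + F (toℕ (Fin.fromℕ q))
      ≈⟨ +-cong (sum-cong-≋ {q} (λ i → reflexive (≡.cong F (Finₚ.toℕ-inject₁ i))))
                (reflexive (≡.cong F (Finₚ.toℕ-fromℕ q))) ⟩
    ∑[ i < q ] F (toℕ i) + F q                              ∎

  ∑-shift : ∀ q (F : ℕ → Carrier) → (∀ a → F (a ℕ.+ q) ≈ F a) →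
            ∀ c → ∑[ a < q ] F (toℕ a ℕ.+ c) ≈ ∑[ a < q ] F (toℕ a)
  ∑-shift q F periodic zero    = sum-cong-≋ {q} (λ a → reflexive (≡.cong F (ℕₚ.+-identityʳ (toℕ a))))
  ∑-shift q F periodic (suc c) = trans (∙-cancelʳ (F c) _ _ shift-by-one) (∑-shift q F periodic c)
    where
    shift-by-one : ∑[ a < q ] F (toℕ a ℕ.+ suc c) + F c ≈ ∑[ a < q ] F (toℕ a ℕ.+ c) + F c
    shift-by-one = begin
      ∑[ a < q ] F (toℕ a ℕ.+ suc c) + F c
        ≈⟨ +-comm _ _ ⟩
      F c + ∑[ a < q ] F (toℕ a ℕ.+ suc c)
        ≈⟨ +-congˡ (sum-cong-≋ {q} (λ a → reflexive (≡.cong F (ℕₚ.+-suc (toℕ a) c)))) ⟩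
      ∑[ a < suc q ] F (toℕ a ℕ.+ c)
        ≈⟨ ∑-init-last q (λ a → F (a ℕ.+ c)) ⟩
      ∑[ a < q ] F (toℕ a ℕ.+ c) + F (q ℕ.+ c)
        ≡⟨ ≡.cong (λ e → ∑[ a < q ] F (toℕ a ℕ.+ c) + F e) (ℕₚ.+-comm q c) ⟩
      ∑[ a < q ] F (toℕ a ℕ.+ c) + F (c ℕ.+ q)
        ≈⟨ +-congˡ (periodic c) ⟩
      ∑[ a < q ] F (toℕ a ℕ.+ c) + F c ∎

  geometric-sum : ∀ y q → y * ∑[ c < q ] pow K y (toℕ c) + 1# ≈ ∑[ c < q ] pow K y (toℕ c) + pow K y q
  geometric-sum y q = begin
    y * ∑[ c < q ] pow K y (toℕ c) + 1#                  ≈⟨ +-comm _ _ ⟩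
    1# + y * ∑[ c < q ] pow K y (toℕ c)                  ≈⟨ +-congˡ (*-distribˡ-sum {q} y (pow K y ∘ toℕ)) ⟩
    ∑[ c < suc q ] pow K y (toℕ c)                       ≈⟨ ∑-init-last q (pow K y) ⟩
    ∑[ c < q ] pow K y (toℕ c) + pow K y q               ∎

  ∑-pow-root-of-unity : IsField K → ∀ {y} q → pow K y q ≈ 1# → ¬ y ≈ 1# → ∑[ c < q ] pow K y (toℕ c) ≈ 0#
  ∑-pow-root-of-unity isField {y} q yᵠ≈1 y≉1 = ≉1∧*-fixed⇒≈0 isField y≉1
    (∙-cancelʳ 1# _ _ (trans (geometric-sum y q) (+-congˡ yᵠ≈1)))

  ∑-pow-primitive-root : IsField K → ∀ {q ξ} → IsPrimitiveRoot K q ξ →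
    ∀ a → 0 ℕ.< a → a ℕ.< q → ∑[ c < q ] pow K (pow K ξ a) (toℕ c) ≈ 0#
  ∑-pow-primitive-root isField {q} {ξ} (ξᵠ≈1 , no-smaller-power) a 0<a a<q =
    ∑-pow-root-of-unity isField q ξᵃᵠ≈1 (no-smaller-power a 0<a a<q)
    where
    ξᵃᵠ≈1 : pow K (pow K ξ a) q ≈ 1#
    ξᵃᵠ≈1 = begin
      pow K (pow K ξ a) q   ≈⟨ pow-* ξ a q ⟨
      pow K ξ (a ℕ.* q)     ≡⟨ ≡.cong (pow K ξ) (ℕₚ.*-comm a q) ⟩
      pow K ξ (q ℕ.* a)     ≈⟨ pow-periodic ξ q ξᵠ≈1 0 a ⟩
      1#                    ∎

  ∑-orthogonality : IsField K → ∀ {q ξ} .{{_ : NonZero q}} → IsPrimitiveRoot K q ξ → (F : ℕ → Carrier) →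
    ∑[ a < q ] (F (toℕ a) * ∑[ c < q ] pow K (pow K ξ (toℕ a)) (toℕ c)) ≈ F 0 * natR K q
  ∑-orthogonality isField {q@(suc q₀)} {ξ} ξ-primitive F = begin
    F 0 * ∑[ c < q ] pow K 1# (toℕ c) + ∑[ a < q₀ ] (F (suc (toℕ a)) * S (suc (toℕ a)))
      ≈⟨ +-cong (*-congˡ ∑1≈q) (trans (sum-cong-≋ {q₀} vanishes) (sum-replicate-zero q₀)) ⟩
    F 0 * natR K q + 0#
      ≈⟨ +-identityʳ _ ⟩
    F 0 * natR K q ∎
    where
    S : ℕ → Carrier
    S a = ∑[ c < q ] pow K (pow K ξ a) (toℕ c)
    ∑1≈q : ∑[ c < q ] pow K 1# (toℕ c) ≈ natR K q
    ∑1≈q = trans (sum-cong-≋ {q} (pow-1# ∘ toℕ)) (trans (sum-replicate q) (reflexive (≡.sym (natR≡×1# q))))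
    vanishes : ∀ a → F (suc (toℕ a)) * S (suc (toℕ a)) ≈ 0#
    vanishes a = trans (*-congˡ (∑-pow-primitive-root isField ξ-primitive (suc (toℕ a)) ℕ.z<s (ℕ.s<s (Finₚ.toℕ<n a))))
                       (zeroʳ _)

  gaussSum : ℕ → Carrier → ℕ → Carrier
  gaussSum q ω b = ∑[ a < q ] pow K ω (quad b (toℕ a))

  gaussSum-*-inverse : IsField K → ∀ q r .{{_ : NonZero q}} → q ≡ r ℕ.* 2 → ∀ {ω ω' ξ} →
    pow K ω (2 ℕ.* q) ≈ 1# → ω * ω' ≈ 1# → ξ ≈ pow K ω 2 → IsPrimitiveRoot K q ξ →
    ∀ b → gaussSum q ω b * gaussSum q ω' b ≈ natR K q
  gaussSum-*-inverse isField q r q≡r*2 {ω} {ω'} {ξ} ω²ᵠ≈1 ωω'≈1 ξ≈ω² ξ-primitive b = begin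
    gaussSum q ω b * gaussSum q ω' b
      ≈⟨ *-distribˡ-sum {q} _ _ ⟩
    ∑[ c < q ] (∑[ a < q ] F (toℕ a) * F' (toℕ c))
      ≈⟨ sum-cong-≋ {q} (λ c → *-congʳ (∑-shift q F F-periodic (toℕ c))) ⟨
    ∑[ c < q ] (∑[ a < q ] F (toℕ a ℕ.+ toℕ c) * F' (toℕ c))
      ≈⟨ sum-cong-≋ {q} (λ c → *-distribʳ-sum {q} _ _) ⟩
    ∑[ c < q ] ∑[ a < q ] (F (toℕ a ℕ.+ toℕ c) * F' (toℕ c))
      ≈⟨ sum-cong-≋ {q} (λ c → sum-cong-≋ {q} (λ a → cross-term (toℕ a) (toℕ c))) ⟩
    ∑[ c < q ] ∑[ a < q ] (F (toℕ a) * pow K (pow K ξ (toℕ a)) (toℕ c))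
      ≈⟨ ∑-comm {q} {q} _ ⟩
    ∑[ a < q ] ∑[ c < q ] (F (toℕ a) * pow K (pow K ξ (toℕ a)) (toℕ c))
      ≈⟨ sum-cong-≋ {q} (λ a → *-distribˡ-sum {q} _ _) ⟨
    ∑[ a < q ] (F (toℕ a) * ∑[ c < q ] pow K (pow K ξ (toℕ a)) (toℕ c))
      ≈⟨ ∑-orthogonality isField ξ-primitive F ⟩
    1# * natR K q
      ≈⟨ *-identityˡ _ ⟩
    natR K q ∎
    where
    F F' : ℕ → Carrier
    F  a = pow K ω  (quad b a)
    F' a = pow K ω' (quad b a)

    F-periodic : ∀ a → F (a ℕ.+ q) ≈ F a
    F-periodic a = trans (reflexive (≡.cong (pow K ω) (quad-periodic b a r q q≡r*2)))
                         (pow-periodic ω (2 ℕ.* q) ω²ᵠ≈1 (quad b a) (a ℕ.+ b ℕ.+ r))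

    cross-term : ∀ a c → F (a ℕ.+ c) * F' c ≈ F a * pow K (pow K ξ a) c
    cross-term a c = begin
      pow K ω (quad b (a ℕ.+ c)) * F' c
        ≡⟨ ≡.cong (λ e → pow K ω e * F' c) (quad-+ b a c) ⟩
      pow K ω (quad b a ℕ.+ 2 ℕ.* (a ℕ.* c) ℕ.+ quad b c) * F' c
        ≈⟨ *-congʳ (trans (pow-+ ω (quad b a ℕ.+ 2 ℕ.* (a ℕ.* c)) (quad b c))
                          (*-congʳ (pow-+ ω (quad b a) (2 ℕ.* (a ℕ.* c))))) ⟩
      F a * pow K ω (2 ℕ.* (a ℕ.* c)) * F c * F' c
        ≈⟨ *-assoc _ (F c) (F' c) ⟩
      F a * pow K ω (2 ℕ.* (a ℕ.* c)) * (F c * F' c)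
        ≈⟨ *-cong (*-congˡ (pow-square ξ≈ω² (a ℕ.* c))) (pow-inverse ωω'≈1 (quad b c)) ⟩
      F a * pow K ξ (a ℕ.* c) * 1#
        ≈⟨ trans (*-identityʳ _) (*-congˡ (pow-* ξ a c)) ⟩
      F a * pow K (pow K ξ a) c ∎

  sumL-cong : ∀ {a} {A : Set a} (xs : List A) {g h : A → Carrier} →
    (∀ x → g x ≈ h x) → sumL K xs g ≈ sumL K xs h
  sumL-cong L.[]       g≈h = refl
  sumL-cong (x L.∷ xs) g≈h = +-cong (g≈h x) (sumL-cong xs g≈h)

  sumL-++ : ∀ {a} {A : Set a} (xs ys : List A) g → sumL K (xs L.++ ys) g ≈ sumL K xs g + sumL K ys g
  sumL-++ L.[]       ys g = sym (+-identityˡ _)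
  sumL-++ (x L.∷ xs) ys g = trans (+-congˡ (sumL-++ xs ys g)) (sym (+-assoc _ _ _))

  sumL-concatMap : ∀ {a b} {A : Set a} {B : Set b} (f : A → List B) xs g →
    sumL K (L.concatMap f xs) g ≈ sumL K xs (λ x → sumL K (f x) g)
  sumL-concatMap f L.[]       g = refl
  sumL-concatMap f (x L.∷ xs) g = trans (sumL-++ (f x) _ g) (+-congˡ (sumL-concatMap f xs g))

  sumL-map : ∀ {a b} {A : Set a} {B : Set b} (f : A → B) xs g → sumL K (L.map f xs) g ≡ sumL K xs (g ∘ f)
  sumL-map f L.[]       g = ≡.refl
  sumL-map f (x L.∷ xs) g = ≡.cong (g (f x) +_) (sumL-map f xs g)

  sumL-tabulate : ∀ {a} {A : Set a} {n} (f : Fin n → A) g → sumL K (L.tabulate f) g ≡ ∑[ i < n ] g (f i)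
  sumL-tabulate {n = zero}  f g = ≡.refl
  sumL-tabulate {n = suc n} f g = ≡.cong (g (f Fin.zero) +_) (sumL-tabulate (f ∘ Fin.suc) g)

  *-distribˡ-sumL : ∀ {a} {A : Set a} x (xs : List A) g → x * sumL K xs g ≈ sumL K xs (λ y → x * g y)
  *-distribˡ-sumL x L.[]       g = zeroʳ x
  *-distribˡ-sumL x (y L.∷ ys) g = trans (distribˡ x _ _) (+-congˡ (*-distribˡ-sumL x ys g))

  ∏ : ∀ {n} → Vec Carrier n → Carrier
  ∏ []       = 1#
  ∏ (x ∷ xs) = x * ∏ xs

  sumL-allVecs-∏ : ∀ q n (g : Fin q → Fin q → Carrier) (u : Vec (Fin q) n) →
    sumL K (allVecs q n) (λ x → ∏ (V.zipWith g u x)) ≈ ∏ (V.map (λ b → ∑[ a < q ] g b a) u)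
  sumL-allVecs-∏ q zero    g []      = +-identityʳ 1#
  sumL-allVecs-∏ q (suc n) g (b ∷ u) = begin
    sumL K (L.concatMap (λ a → L.map (a ∷_) (allVecs q n)) (L.allFin q)) (λ x → ∏ (V.zipWith g (b ∷ u) x))
      ≈⟨ sumL-concatMap _ (L.allFin q) _ ⟩
    sumL K (L.allFin q) (λ a → sumL K (L.map (a ∷_) (allVecs q n)) (λ x → ∏ (V.zipWith g (b ∷ u) x)))
      ≈⟨ sumL-cong (L.allFin q) (λ a → reflexive (sumL-map (a ∷_) (allVecs q n) _)) ⟩
    sumL K (L.allFin q) (λ a → sumL K (allVecs q n) (λ x → g b a * ∏ (V.zipWith g u x)))
      ≈⟨ sumL-cong (L.allFin q) (λ a → trans (sym (*-distribˡ-sumL (g b a) (allVecs q n) _))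
                                             (*-congˡ (sumL-allVecs-∏ q n g u))) ⟩
    sumL K (L.allFin q) (λ a → g b a * Π)
      ≡⟨ sumL-tabulate {n = q} (λ a → a) (λ a → g b a * Π) ⟩
    ∑[ a < q ] (g b a * Π)
      ≈⟨ *-distribʳ-sum {q} Π (g b) ⟨
    ∑[ a < q ] g b a * Π ∎
    where
    Π : Carrier
    Π = ∏ (V.map (λ b → ∑[ a < q ] g b a) u)

  pow-sumSqHat-innerHat : ∀ ω {q n} (x u : Vec (Fin q) n) →
    pow K ω (sumSqHat x ℕ.+ 2 ℕ.* innerHat x u) ≈ ∏ (V.zipWith (λ b a → pow K ω (quad (toℕ b) (toℕ a))) u x)
  pow-sumSqHat-innerHat ω []      []      = refl
  pow-sumSqHat-innerHat ω (a ∷ x) (b ∷ u) = begin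
    pow K ω (sumSqHat (a ∷ x) ℕ.+ 2 ℕ.* innerHat (a ∷ x) (b ∷ u))
      ≡⟨ ≡.cong (pow K ω) (sumSqHat-+-innerHat-∷ a b x u) ⟩
    pow K ω (quad (toℕ b) (toℕ a) ℕ.+ (sumSqHat x ℕ.+ 2 ℕ.* innerHat x u))
      ≈⟨ pow-+ ω (quad (toℕ b) (toℕ a)) _ ⟩
    pow K ω (quad (toℕ b) (toℕ a)) * pow K ω (sumSqHat x ℕ.+ 2 ℕ.* innerHat x u)
      ≈⟨ *-congˡ (pow-sumSqHat-innerHat ω x u) ⟩
    ∏ (V.zipWith (λ b a → pow K ω (quad (toℕ b) (toℕ a))) (b ∷ u) (a ∷ x)) ∎

  negaSum-fQuad : ∀ q .{{_ : NonZero q}} n {ω ξ} → pow K ω (2 ℕ.* q) ≈ 1# → ξ ≈ pow K ω 2 →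
    ∀ u → negaSum K q n ω ξ (fQuad q n) u ≈ ∏ (V.map (gaussSum q ω ∘ toℕ) u)
  negaSum-fQuad q n {ω} {ξ} ω²ᵠ≈1 ξ≈ω² u =
    trans (sumL-cong (allVecs q n) summand) (sumL-allVecs-∏ q n _ u)
    where
    summand : ∀ x → pow K ω (toℕ (fQuad q n x)) * pow K ξ (innerHat x u) * pow K ω (sumHat x) ≈
                    ∏ (V.zipWith (λ b a → pow K ω (quad (toℕ b) (toℕ a))) u x)
    summand x with fQuad-exponent q n x u
    ... | k , exponent = begin
      pow K ω r * pow K ξ I * pow K ω T                 ≈⟨ *-congʳ (*-congˡ (pow-square ξ≈ω² I)) ⟨
      pow K ω r * pow K ω (2 ℕ.* I) * pow K ω T         ≈⟨ *-congʳ (pow-+ ω r (2 ℕ.* I)) ⟨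
      pow K ω (r ℕ.+ 2 ℕ.* I) * pow K ω T               ≈⟨ pow-+ ω (r ℕ.+ 2 ℕ.* I) T ⟨
      pow K ω (r ℕ.+ 2 ℕ.* I ℕ.+ T)                     ≈⟨ pow-periodic ω (2 ℕ.* q) ω²ᵠ≈1 (r ℕ.+ 2 ℕ.* I ℕ.+ T) k ⟨
      pow K ω (r ℕ.+ 2 ℕ.* I ℕ.+ T ℕ.+ 2 ℕ.* q ℕ.* k)   ≡⟨ ≡.cong (pow K ω) exponent ⟨
      pow K ω (sumSqHat x ℕ.+ 2 ℕ.* I)                  ≈⟨ pow-sumSqHat-innerHat ω x u ⟩
      ∏ (V.zipWith (λ b a → pow K ω (quad (toℕ b) (toℕ a))) u x) ∎
      where
      r I T : ℕ
      r = toℕ (fQuad q n x)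
      I = innerHat x u
      T = sumHat x

  ∏-map-*-natR : ∀ {a} {A : Set a} {f g : A → Carrier} {m} → (∀ b → f b * g b ≈ natR K m) →
    ∀ {n} (u : Vec A n) → ∏ (V.map f u) * ∏ (V.map g u) ≈ natR K (m ℕ.^ n)
  ∏-map-*-natR fg≈m []      = trans (*-identityˡ 1#) (sym (+-identityʳ 1#))
  ∏-map-*-natR {f = f} {g} {m} fg≈m {suc n} (b ∷ u) = begin
    f b * ∏ (V.map f u) * (g b * ∏ (V.map g u))       ≈⟨ interchange _ _ _ _ ⟩
    f b * g b * (∏ (V.map f u) * ∏ (V.map g u))       ≈⟨ *-cong (fg≈m b) (∏-map-*-natR fg≈m u) ⟩
    natR K m * natR K (m ℕ.^ n)                       ≈⟨ natR-* m (m ℕ.^ n) ⟨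
    natR K (m ℕ.^ suc n)                              ∎

  fQuad-negabent : IsField K → ∀ q .{{_ : NonZero q}} → 2 ∣ q → ∀ n {ω ξ} →
    IsPrimitiveRoot K (2 ℕ.* q) ω → IsPrimitiveRoot K q ξ → ξ ≈ pow K ω 2 →
    IsNegabent K q n ω ξ (fQuad q n)
  fQuad-negabent isField q@(suc _) (divides r q≡r*2) n {ω} {ξ} (ω²ᵠ≈1 , _) ξ-primitive@(ξᵠ≈1 , _) ξ≈ω² u = begin
    negaSum K q n ω ξ (fQuad q n) u * negaSum K q n ω' ξ' (fQuad q n) u
      ≈⟨ *-cong (negaSum-fQuad q n ω²ᵠ≈1 ξ≈ω² u) (negaSum-fQuad q n ω'²ᵠ≈1 ξ'≈ω'² u) ⟩
    ∏ (V.map (gaussSum q ω ∘ toℕ) u) * ∏ (V.map (gaussSum q ω' ∘ toℕ) u)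
      ≈⟨ ∏-map-*-natR (gaussSum-*-inverse isField q r q≡r*2 ω²ᵠ≈1 ωω'≈1 ξ≈ω² ξ-primitive ∘ toℕ) u ⟩
    natR K (q ℕ.^ n) ∎
    where
    ω' ξ' : Carrier
    ω' = pow K ω (2 ℕ.* q ℕ.∸ 1)
    ξ' = pow K ξ (q ℕ.∸ 1)
    ωω'≈1 : ω * ω' ≈ 1#
    ωω'≈1 = pow-pred-inverse ω (2 ℕ.* q) ω²ᵠ≈1
    ω'²ᵠ≈1 : pow K ω' (2 ℕ.* q) ≈ 1#
    ω'²ᵠ≈1 = inverse-pow≈1 (2 ℕ.* q) ωω'≈1 ω²ᵠ≈1
    ξ'≈ω'² : ξ' ≈ pow K ω' 2
    ξ'≈ω'² = inverse-unique (pow-pred-inverse ξ q ξᵠ≈1) (trans (*-congʳ ξ≈ω²) (pow-inverse ωω'≈1 2))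

open GaussSums using (fQuad-negabent)
open import Data.Nat using (_≥_; _*_)

theorem7 : ∀ {c ℓ} (K : CommutativeRing c ℓ) → IsField K → CharacteristicZero K →
    (q : ℕ) .{{_ : NonZero q}} → 2 ∣ q → (n : ℕ) → n ≥ 1 →
    (ω ξ : CommutativeRing.Carrier K) →
    IsPrimitiveRoot K (2 * q) ω → IsPrimitiveRoot K q ξ →
    CommutativeRing._≈_ K ξ (pow K ω 2) →
    IsNegabent K q n ω ξ (fQuad q n)
theorem7 K isField _ q 2∣q n _ ω ξ = fQuad-negabent K isField q 2∣q n
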